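{- Let $G$ be a connected graph with minimum degree $\delta(G)\ge2$, and let $T_{\mathcal{B}}$ be a reduced block tree of $G$. If $B$ is a block of $G$ with $B=\{u,v\}$, then there exist distinct blocks $B_u,B_v$ of $G$, both adjacent to $B$ in $T_{\mathcal{B}}$, with $u\in B_u$ and $v\in B_v$.
   Context: A block of a graph $G$ is a maximal set $B\subseteq V(G)$ such that for any two vertices $x,y\in B$ with $xy\notin E(G)$, at least $2$ vertices must be removed from $G$ to separate $x$ from $y$. The block decomposition $\mathcal{B}(G)$ is the set of all blocks. The block graph $G_{\mathcal{B}}$ has vertex set $\mathcal{B}(G)$, with $B_1B_2$ an edge iff $B_1\cap B_2\ne\emptyset$. A reduced block tree of a connected graph $G$ is a spanning tree $T_{\mathcal{B}}$ of $G_{\mathcal{B}}$. -}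

module Defs where

open import Data.Nat using (ℕ; _≤_)
open import Data.Bool using (Bool; true; false)
open import Data.Fin using (Fin)
open import Data.Fin.Subset using (Subset; _∈_; _∉_; _⊆_; _∩_; ∣_∣; ⊥; Nonempty)
open import Data.Vec using (tabulate)
open import Data.Product using (_×_; Σ; ∃)
open import Data.List using (List; _∷_; []; _++_; length)
open import Data.List.Relation.Unary.Linked using (Linked)
open import Data.List.Relation.Unary.Unique.Propositional using (Unique)
open import Relation.Binary.PropositionalEquality using (_≡_; _≢_)
open import Relation.Binary.Construct.Closure.ReflexiveTransitive using (Star)
open import Relation.Nullary using (¬_)

record Graph (n : ℕ) : Set where
  field
    adj    : Fin n → Fin n → Bool
    sym    : ∀ x y → adj x y ≡ adj y x
    irrefl : ∀ x → adj x x ≡ false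
open Graph public

Edge : ∀ {n} → Graph n → Fin n → Fin n → Set
Edge G x y = adj G x y ≡ true

N : ∀ {n} → Graph n → Fin n → Subset n
N G v = tabulate (adj G v)

degree : ∀ {n} → Graph n → Fin n → ℕ
degree G v = ∣ N G v ∣

MinDegree≥ : ∀ {n} → Graph n → ℕ → Set
MinDegree≥ G k = ∀ v → k ≤ degree G v

data PathAvoiding {n} (G : Graph n) (S : Subset n) : Fin n → Fin n → Set where
  here : ∀ {x} → x ∉ S → PathAvoiding G S x x
  step : ∀ {x y z} → x ∉ S → Edge G x y → PathAvoiding G S y z → PathAvoiding G S x z

Connected : ∀ {n} → Graph n → Set
Connected G = ∀ x y → PathAvoiding G ⊥ x y

NotSeparableBy<2 : ∀ {n} → Graph n → Fin n → Fin n → Set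
NotSeparableBy<2 G x y = ∀ (S : Subset n) → ∣ S ∣ ≤ 1 → x ∉ S → y ∉ S → PathAvoiding G S x y
  where n = _

BlockProperty : ∀ {n} → Graph n → Subset n → Set
BlockProperty G B = ∀ x y → x ∈ B → y ∈ B → ¬ Edge G x y → NotSeparableBy<2 G x y

IsBlock : ∀ {n} → Graph n → Subset n → Set
IsBlock G B = BlockProperty G B × (∀ B′ → B ⊆ B′ → BlockProperty G B′ → B′ ⊆ B)

BlockGraphAdj : ∀ {n} → Graph n → Subset n → Subset n → Set
BlockGraphAdj G B₁ B₂ = IsBlock G B₁ × IsBlock G B₂ × B₁ ≢ B₂ × Nonempty (B₁ ∩ B₂)

-- a cycle in a relation R: at least 3 distinct vertices, consecutive ones related, closing up
HasCycle : ∀ {A : Set} → (A → A → Set) → Set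
HasCycle {A} R = Σ A λ x → Σ (List A) λ xs →
  2 ≤ length xs × Unique (x ∷ xs) × Linked R (x ∷ xs ++ x ∷ [])

record ReducedBlockTree {n} (G : Graph n) : Set₁ where
  field
    tadj      : Subset n → Subset n → Set
    subgraph  : ∀ {B₁ B₂} → tadj B₁ B₂ → BlockGraphAdj G B₁ B₂
    symmetric : ∀ {B₁ B₂} → tadj B₁ B₂ → tadj B₂ B₁
    spanning  : ∀ {B₁ B₂} → IsBlock G B₁ → IsBlock G B₂ → Star tadj B₁ B₂
    acyclic   : ¬ HasCycle tadj
open ReducedBlockTree public

-- Since v has degree at least 2 it has a neighbour w ≠ u, and the block containing the
-- edge vw differs from B. Two distinct blocks sharing a vertex u cannot be joined by a
-- path avoiding u, since their union would again have the block property. Hence along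
-- the tree path from the block of vw to B every block lies in the component of G - u
-- containing v, and the last one is a tree neighbour of B containing v but not u.
-- Symmetrically for u; the two neighbours differ as only one of them contains u.
module Submission where

open import Defs hiding (sym)
open import Data.Nat using (ℕ; _≤_; _<_; _≤?_)
open import Data.Nat.Properties using (≤-reflexive; ≤-trans; <-irrefl; <-≤-trans; module ≤-Reasoning)
open import Data.Fin using (Fin)
open import Data.Fin.Properties using (any?; all?) renaming (_≟_ to _≟ᶠ_)
open import Data.Fin.Subset using (Subset; _∈_; _∉_; _∪_; _∩_; ⁅_⁆; _⊆_; _⊃_; ∣_∣; Nonempty; _-_)
open import Data.Fin.Subset.Properties
  using (_∈?_; _⊂?_; anySubset?; x∈⁅x⁆; x∈⁅y⁆⇒x≡y; ∣⁅x⁆∣≡1; p⊆q⇒∣p∣≤∣q∣;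
         x∈p⇒∣p-x∣<∣p∣; x∈p∧x≢y⇒x∈p-y; ⊆-antisym; x∈p∪q⁻; x∈p∪q⁺; x∈p∩q⁻; ∪-comm)
open import Data.Fin.Subset.Induction using (⊃-wellFounded; Acc; acc)
open import Data.Vec using (tabulate)
open import Data.Vec.Properties using (lookup∘tabulate; []=⇒lookup; lookup⇒[]=; ≡-dec)
open import Data.Bool using (Bool; true)
open import Data.Bool.Properties using (T-≡) renaming (_≟_ to _≟ᵇ_)
open import Data.Product using (_×_; Σ; Σ-syntax; ∃; _,_; proj₁; proj₂)
open import Data.Sum using (_⊎_; inj₁; inj₂)
open import Data.Empty using (⊥-elim)
open import Function using (_∘_; id; Equivalence)
open import Relation.Binary.PropositionalEquality using (_≡_; _≢_; refl; trans; subst; sym)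
open import Relation.Binary.Construct.Closure.ReflexiveTransitive using (Star; ε; _◅_)
open import Relation.Nullary using (¬_; Dec; yes; no)
open import Relation.Nullary.Decidable
  using (isYes; toWitness; fromWitness; _×-dec_; _⊎-dec_; _→-dec_; ¬?)

private
  variable
    n : ℕ

∣⁅x⁆∣≤1 : (x : Fin n) → ∣ ⁅ x ⁆ ∣ ≤ 1
∣⁅x⁆∣≤1 x = ≤-reflexive (∣⁅x⁆∣≡1 x)

∣p∣≤1∧x∈p⇒p⊆⁅x⁆ : {p : Subset n} {x : Fin n} → ∣ p ∣ ≤ 1 → x ∈ p → p ⊆ ⁅ x ⁆
∣p∣≤1∧x∈p⇒p⊆⁅x⁆ {p = p} {x} ∣p∣≤1 x∈p {y} y∈p with y ≟ᶠ x
... | yes refl = x∈⁅x⁆ y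
... | no y≢x = ⊥-elim (<-irrefl refl 1<1)
  where
  open ≤-Reasoning
  1<1 : 1 < 1
  1<1 = begin-strict
    1           ≡⟨ sym (∣⁅x⁆∣≡1 y) ⟩
    ∣ ⁅ y ⁆ ∣   ≤⟨ p⊆q⇒∣p∣≤∣q∣ (λ z∈⁅y⁆ → subst (_∈ p - x) (sym (x∈⁅y⁆⇒x≡y _ z∈⁅y⁆)) (x∈p∧x≢y⇒x∈p-y y∈p y≢x)) ⟩
    ∣ p - x ∣   <⟨ x∈p⇒∣p-x∣<∣p∣ x∈p ⟩
    ∣ p ∣       ≤⟨ ∣p∣≤1 ⟩
    1           ∎

x∈⁅y⁆∪⁅z⁆⁻ : {x y z : Fin n} → x ∈ ⁅ y ⁆ ∪ ⁅ z ⁆ → x ≡ y ⊎ x ≡ z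
x∈⁅y⁆∪⁅z⁆⁻ {y = y} {z} x∈ with x∈p∪q⁻ ⁅ y ⁆ ⁅ z ⁆ x∈
... | inj₁ x∈⁅y⁆ = inj₁ (x∈⁅y⁆⇒x≡y y x∈⁅y⁆)
... | inj₂ x∈⁅z⁆ = inj₂ (x∈⁅y⁆⇒x≡y z x∈⁅z⁆)

∈-tabulate⁺ : (f : Fin n → Bool) {x : Fin n} → f x ≡ true → x ∈ tabulate f
∈-tabulate⁺ f {x} fx = lookup⇒[]= x _ (trans (lookup∘tabulate f x) fx)

∈-tabulate⁻ : (f : Fin n → Bool) {x : Fin n} → x ∈ tabulate f → f x ≡ true
∈-tabulate⁻ f {x} x∈ = trans (sym (lookup∘tabulate f x)) ([]=⇒lookup x∈)

module _ {P : Fin n → Set} (P? : ∀ x → Dec (P x)) where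

  subsetOf : Subset n
  subsetOf = tabulate (isYes ∘ P?)

  ∈-subsetOf⁺ : ∀ {x} → P x → x ∈ subsetOf
  ∈-subsetOf⁺ Px = ∈-tabulate⁺ _ (Equivalence.to T-≡ (fromWitness Px))

  ∈-subsetOf⁻ : ∀ {x} → x ∈ subsetOf → P x
  ∈-subsetOf⁻ x∈ = toWitness (Equivalence.from T-≡ (∈-tabulate⁻ _ x∈))

allSubsets? : {P : Subset n → Set} → (∀ p → Dec (P p)) → Dec (∀ p → P p)
allSubsets? {P = P} P? with anySubset? (¬? ∘ P?)
... | yes (p , ¬Pp) = no (λ ∀P → ¬Pp (∀P p))
... | no ∄¬P = yes holds
  where
  holds : ∀ p → P p
  holds p with P? p
  ... | yes Pp = Pp
  ... | no ¬Pp = ⊥-elim (∄¬P (p , ¬Pp))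

saturate : (F : Subset n → Subset n) → (∀ {p} → p ⊆ F p) →
           (P : Subset n → Set) → (∀ {p} → P p → P (F p)) →
           ∀ p → P p → Σ[ c ∈ Subset n ] p ⊆ c × F c ⊆ c × P c
saturate {n} F inflationary P preserved p = go p (⊃-wellFounded p)
  where
  go : ∀ p → Acc _⊃_ p → P p → Σ[ c ∈ Subset n ] p ⊆ c × F c ⊆ c × P c
  go p (acc rec) Pp with p ⊂? F p
  ... | yes p⊂Fp =
    let c , Fp⊆c , closed , Pc = go (F p) (rec p⊂Fp) (preserved Pp)
    in c , Fp⊆c ∘ inflationary , closed , Pc
  ... | no p⊄Fp = p , id , Fp⊆p , Pp
    where
    Fp⊆p : F p ⊆ p
    Fp⊆p {x} x∈Fp with x ∈? p
    ... | yes x∈p = x∈p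
    ... | no x∉p = ⊥-elim (p⊄Fp (inflationary , x , x∈Fp , x∉p))

extendToMaximal : {P : Subset n → Set} → (∀ p → Dec (P p)) → ∀ p → P p →
                  Σ[ m ∈ Subset n ] p ⊆ m × P m × (∀ q → m ⊆ q → P q → q ⊆ m)
extendToMaximal {n} {P = P} P? p = go p (⊃-wellFounded p)
  where
  go : ∀ p → Acc _⊃_ p → P p → Σ[ m ∈ Subset n ] p ⊆ m × P m × (∀ q → m ⊆ q → P q → q ⊆ m)
  go p (acc rec) Pp with anySubset? (λ q → (p ⊂? q) ×-dec P? q)
  ... | yes (q , p⊂q , Pq) =
    let m , q⊆m , Pm , maximal = go q (rec p⊂q) Pq in m , q⊆m ∘ proj₁ p⊂q , Pm , maximal
  ... | no ∄larger = p , id , Pp , maximal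
    where
    maximal : ∀ q → p ⊆ q → P q → q ⊆ p
    maximal q p⊆q Pq {x} x∈q with x ∈? p
    ... | yes x∈p = x∈p
    ... | no x∉p = ⊥-elim (∄larger (q , (p⊆q , x , x∈q , x∉p) , Pq))

module _ {G : Graph n} where

  edge-sym : ∀ {x y} → Edge G x y → Edge G y x
  edge-sym {x} {y} xy = trans (sym (Graph.sym G x y)) xy

  start∉ : ∀ {S x y} → PathAvoiding G S x y → x ∉ S
  start∉ (here x∉S) = x∉S
  start∉ (step x∉S _ _) = x∉S

  end∉ : ∀ {S x y} → PathAvoiding G S x y → y ∉ S
  end∉ (here y∉S) = y∉S
  end∉ (step _ _ rest) = end∉ rest

  infixr 5 _++ₚ_
  _++ₚ_ : ∀ {S x y z} → PathAvoiding G S x y → PathAvoiding G S y z → PathAvoiding G S x z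
  here _ ++ₚ q = q
  step x∉S xy p ++ₚ q = step x∉S xy (p ++ₚ q)

  reverse : ∀ {S x y} → PathAvoiding G S x y → PathAvoiding G S y x
  reverse (here y∉S) = here y∉S
  reverse (step x∉S xy p) = reverse p ++ₚ step (start∉ p) (edge-sym xy) (here x∉S)

  avoiding-antimono : ∀ {S S′ x y} → S ⊆ S′ → PathAvoiding G S′ x y → PathAvoiding G S x y
  avoiding-antimono S⊆S′ (here x∉S′) = here (x∉S′ ∘ S⊆S′)
  avoiding-antimono S⊆S′ (step x∉S′ xy p) = step (x∉S′ ∘ S⊆S′) xy (avoiding-antimono S⊆S′ p)

module _ (G : Graph n) where

  edge? : ∀ x y → Dec (Edge G x y)
  edge? x y = adj G x y ≟ᵇ true

  module Reachability (S : Subset n) (z : Fin n) where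

    ReachesTarget : Subset n → Set
    ReachesTarget X = ∀ {x} → x ∈ X → PathAvoiding G S x z

    reachesTarget-⁅z⁆ : z ∉ S → ReachesTarget ⁅ z ⁆
    reachesTarget-⁅z⁆ z∉S y∈⁅z⁆ rewrite x∈⁅y⁆⇒x≡y z y∈⁅z⁆ = here z∉S

    grow : Subset n → Subset n
    grow X = subsetOf (λ x → (x ∈? X) ⊎-dec (¬? (x ∈? S) ×-dec any? (λ y → edge? x y ×-dec (y ∈? X))))

    ⊆-grow : ∀ {X} → X ⊆ grow X
    ⊆-grow x∈X = ∈-subsetOf⁺ _ (inj₁ x∈X)

    grow-reaches : ∀ {X} → ReachesTarget X → ReachesTarget (grow X)
    grow-reaches reaches x∈ with ∈-subsetOf⁻ _ x∈
    ... | inj₁ x∈X = reaches x∈X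
    ... | inj₂ (x∉S , y , xy , y∈X) = step x∉S xy (reaches y∈X)

    closed-contains-reaching : ∀ {C} → grow C ⊆ C → z ∈ C → ∀ {x} → PathAvoiding G S x z → x ∈ C
    closed-contains-reaching closed z∈C (here _) = z∈C
    closed-contains-reaching closed z∈C (step x∉S xy p) =
      closed (∈-subsetOf⁺ _ (inj₂ (x∉S , _ , xy , closed-contains-reaching closed z∈C p)))

    reaches? : ∀ x → Dec (PathAvoiding G S x z)
    reaches? x with z ∈? S
    ... | yes z∈S = no (λ p → end∉ p z∈S)
    ... | no z∉S with saturate grow ⊆-grow ReachesTarget grow-reaches ⁅ z ⁆ (reachesTarget-⁅z⁆ z∉S)
    ...   | C , ⁅z⁆⊆C , closed , reaches with x ∈? C
    ...     | yes x∈C = yes (reaches x∈C)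
    ...     | no x∉C = no (x∉C ∘ closed-contains-reaching closed (⁅z⁆⊆C (x∈⁅x⁆ z)))

  pathAvoiding? : ∀ S x y → Dec (PathAvoiding G S x y)
  pathAvoiding? S x y = Reachability.reaches? S y x

  -- Blocks are obtained as maximal extensions, which constructively needs this decision.
  blockProperty? : ∀ W → Dec (BlockProperty G W)
  blockProperty? W = all? λ x → all? λ y →
    (x ∈? W) →-dec (y ∈? W) →-dec ¬? (edge? x y) →-dec allSubsets? λ S →
    (∣ S ∣ ≤? 1) →-dec ¬? (x ∈? S) →-dec ¬? (y ∈? S) →-dec pathAvoiding? S x y

  extendToBlock : ∀ {W} → BlockProperty G W → Σ[ B ∈ Subset n ] W ⊆ B × IsBlock G B
  extendToBlock {W} = extendToMaximal blockProperty? W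

  blockProperty-edge : ∀ {x y} → Edge G x y → BlockProperty G (⁅ x ⁆ ∪ ⁅ y ⁆)
  blockProperty-edge {x} {y} xy a b a∈ b∈ ¬ab S _ a∉S _ with x∈⁅y⁆∪⁅z⁆⁻ a∈ | x∈⁅y⁆∪⁅z⁆⁻ b∈
  ... | inj₁ refl | inj₁ refl = here a∉S
  ... | inj₁ refl | inj₂ refl = ⊥-elim (¬ab xy)
  ... | inj₂ refl | inj₁ refl = ⊥-elim (¬ab (edge-sym {G = G} xy))
  ... | inj₂ refl | inj₂ refl = here a∉S

  blockProperty⇒path : ∀ {W S x y} → BlockProperty G W → x ∈ W → y ∈ W →
                       ∣ S ∣ ≤ 1 → x ∉ S → y ∉ S → PathAvoiding G S x y
  blockProperty⇒path {x = x} {y} bpW x∈W y∈W ∣S∣≤1 x∉S y∉S with edge? x y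
  ... | yes xy = step x∉S xy (here y∉S)
  ... | no ¬xy = bpW x y x∈W y∈W ¬xy _ ∣S∣≤1 x∉S y∉S

  -- A separator S of size ≤ 1 either spares u, which then links everything, or is {u},
  -- and then the path from a to b crosses between the two sides.
  blockProperty-∪ : ∀ {W₁ W₂ u a b} → BlockProperty G W₁ → BlockProperty G W₂ →
                    u ∈ W₁ → u ∈ W₂ → a ∈ W₁ → b ∈ W₂ → PathAvoiding G ⁅ u ⁆ a b →
                    BlockProperty G (W₁ ∪ W₂)
  blockProperty-∪ {W₁} {W₂} {u} {a} {b} bp₁ bp₂ u∈W₁ u∈W₂ a∈W₁ b∈W₂ a⇝b x y x∈ y∈ _ S ∣S∣≤1 x∉S y∉S
    with u ∈? S
  ... | no u∉S = toU x∈ x∉S ++ₚ reverse (toU y∈ y∉S)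
    where
    toU : ∀ {w} → w ∈ W₁ ∪ W₂ → w ∉ S → PathAvoiding G S w u
    toU w∈ w∉S with x∈p∪q⁻ W₁ W₂ w∈
    ... | inj₁ w∈W₁ = blockProperty⇒path bp₁ w∈W₁ u∈W₁ ∣S∣≤1 w∉S u∉S
    ... | inj₂ w∈W₂ = blockProperty⇒path bp₂ w∈W₂ u∈W₂ ∣S∣≤1 w∉S u∉S
  ... | yes u∈S = across (x∈p∪q⁻ W₁ W₂ x∈) (x∈p∪q⁻ W₁ W₂ y∈) x∉S y∉S
    where
    S⊆⁅u⁆ = ∣p∣≤1∧x∈p⇒p⊆⁅x⁆ ∣S∣≤1 u∈S
    a∉S = start∉ a⇝b ∘ S⊆⁅u⁆
    b∉S = end∉ a⇝b ∘ S⊆⁅u⁆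
    crossing : ∀ {x y} → x ∈ W₁ → y ∈ W₂ → x ∉ S → y ∉ S → PathAvoiding G S x y
    crossing x∈W₁ y∈W₂ x∉S y∉S =
      blockProperty⇒path bp₁ x∈W₁ a∈W₁ ∣S∣≤1 x∉S a∉S ++ₚ
      avoiding-antimono S⊆⁅u⁆ a⇝b ++ₚ
      blockProperty⇒path bp₂ b∈W₂ y∈W₂ ∣S∣≤1 b∉S y∉S
    across : ∀ {x y} → x ∈ W₁ ⊎ x ∈ W₂ → y ∈ W₁ ⊎ y ∈ W₂ → x ∉ S → y ∉ S → PathAvoiding G S x y
    across (inj₁ x∈W₁) (inj₁ y∈W₁) = blockProperty⇒path bp₁ x∈W₁ y∈W₁ ∣S∣≤1
    across (inj₂ x∈W₂) (inj₂ y∈W₂) = blockProperty⇒path bp₂ x∈W₂ y∈W₂ ∣S∣≤1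
    across (inj₁ x∈W₁) (inj₂ y∈W₂) = crossing x∈W₁ y∈W₂
    across (inj₂ x∈W₂) (inj₁ y∈W₁) x∉S y∉S = reverse (crossing y∈W₁ x∈W₂ y∉S x∉S)

  block-⊆⇒≡ : ∀ {B Y} → IsBlock G B → IsBlock G Y → Y ⊆ B → Y ≡ B
  block-⊆⇒≡ (bpB , _) (_ , maximalY) Y⊆B = ⊆-antisym Y⊆B (maximalY _ Y⊆B bpB)

  cutVertex-separates : ∀ {B Y u a b} → IsBlock G B → IsBlock G Y → Y ≢ B →
                        u ∈ B → u ∈ Y → a ∈ B → b ∈ Y → ¬ PathAvoiding G ⁅ u ⁆ a b
  cutVertex-separates {B} {Y} isB@(bpB , maximalB) isY Y≢B u∈B u∈Y a∈B b∈Y a⇝b =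
    Y≢B (block-⊆⇒≡ isB isY (maximalB (B ∪ Y) (x∈p∪q⁺ ∘ inj₁) bp∪ ∘ x∈p∪q⁺ ∘ inj₂))
    where
    bp∪ = blockProperty-∪ bpB (proj₁ isY) u∈B u∈Y a∈B b∈Y a⇝b

  neighbour-≢ : MinDegree≥ G 2 → ∀ u v → ∃ λ w → Edge G v w × w ≢ u
  neighbour-≢ δ≥2 u v with any? (λ w → edge? v w ×-dec ¬? (w ≟ᶠ u))
  ... | yes found = found
  ... | no none = ⊥-elim (<-irrefl refl (<-≤-trans (δ≥2 v) (≤-trans (p⊆q⇒∣p∣≤∣q∣ N⊆⁅u⁆) (∣⁅x⁆∣≤1 u))))
    where
    N⊆⁅u⁆ : N G v ⊆ ⁅ u ⁆
    N⊆⁅u⁆ {w} w∈N with w ≟ᶠ u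
    ... | yes refl = x∈⁅x⁆ u
    ... | no w≢u = ⊥-elim (none (w , ∈-tabulate⁻ (adj G v) w∈N , w≢u))

module TreeWalk {G : Graph n} (T : ReducedBlockTree G) {B : Subset n} (isB : IsBlock G B)
         {u v : Fin n} (u∈B : u ∈ B) (v∈B : v ∈ B) where

  ReachableAvoiding : Subset n → Set
  ReachableAvoiding X = ∀ {x} → x ∈ X → PathAvoiding G ⁅ u ⁆ v x

  reachableAvoiding⇒∉ : ∀ {X} → ReachableAvoiding X → u ∉ X
  reachableAvoiding⇒∉ reachable u∈X = end∉ (reachable u∈X) (x∈⁅x⁆ u)

  reachableAvoiding-spread : ∀ {X Y z} → ReachableAvoiding X → IsBlock G Y → Y ≢ B →
                             z ∈ X → z ∈ Y → ReachableAvoiding Y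
  reachableAvoiding-spread reachable isY Y≢B z∈X z∈Y y∈Y =
    v⇝z ++ₚ blockProperty⇒path G (proj₁ isY) z∈Y y∈Y (∣⁅x⁆∣≤1 u) (end∉ v⇝z) y∉⁅u⁆
    where
    v⇝z = reachable z∈X
    u∉Y : u ∉ _
    u∉Y u∈Y = cutVertex-separates G isB isY Y≢B u∈B u∈Y v∈B z∈Y v⇝z
    y∉⁅u⁆ = λ y∈⁅u⁆ → u∉Y (subst (_∈ _) (x∈⁅y⁆⇒x≡y u y∈⁅u⁆) y∈Y)

  lastBlockBefore : ∀ {X} → Star (tadj T) X B → ReachableAvoiding X →
                    Σ[ X′ ∈ Subset n ] ReachableAvoiding X′ × tadj T X′ B
  lastBlockBefore ε reachable = ⊥-elim (reachableAvoiding⇒∉ reachable u∈B)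
  lastBlockBefore {X} (_◅_ {j = Y} X~Y Y⇝B) reachable with ≡-dec _≟ᵇ_ Y B
  ... | yes refl = X , reachable , X~Y
  ... | no Y≢B =
    let _ , isY , _ , z , z∈X∩Y = subgraph T X~Y
        z∈X , z∈Y = x∈p∩q⁻ X Y z∈X∩Y
    in lastBlockBefore Y⇝B (reachableAvoiding-spread reachable isY Y≢B z∈X z∈Y)

otherBlockAt : {G : Graph n} → MinDegree≥ G 2 → (u v : Fin n) →
               Σ[ Y ∈ Subset n ] IsBlock G Y × v ∈ Y × Y ≢ ⁅ u ⁆ ∪ ⁅ v ⁆
otherBlockAt {G = G} δ≥2 u v with neighbour-≢ G δ≥2 u v
... | w , vw , w≢u with extendToBlock G (blockProperty-edge G vw)
...   | Y , vw⊆Y , isY = Y , isY , vw⊆Y (x∈p∪q⁺ (inj₁ (x∈⁅x⁆ v))) , Y≢B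
  where
  Y≢B : Y ≢ ⁅ u ⁆ ∪ ⁅ v ⁆
  Y≢B Y≡B with x∈⁅y⁆∪⁅z⁆⁻ (subst (w ∈_) Y≡B (vw⊆Y (x∈p∪q⁺ (inj₂ (x∈⁅x⁆ w)))))
  ... | inj₁ w≡u = w≢u w≡u
  ... | inj₂ refl with trans (sym (Graph.irrefl G v)) vw
  ...   | ()

module PairBlock {G : Graph n} (δ≥2 : MinDegree≥ G 2) (T : ReducedBlockTree G)
                 {u v : Fin n} (u≢v : u ≢ v) (isB : IsBlock G (⁅ u ⁆ ∪ ⁅ v ⁆)) where

  open TreeWalk T isB (x∈p∪q⁺ (inj₁ (x∈⁅x⁆ u))) (x∈p∪q⁺ (inj₂ (x∈⁅x⁆ v)))

  reachableAvoiding-⁅v⁆ : ReachableAvoiding ⁅ v ⁆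
  reachableAvoiding-⁅v⁆ x∈⁅v⁆ rewrite x∈⁅y⁆⇒x≡y v x∈⁅v⁆ = here (u≢v ∘ sym ∘ x∈⁅y⁆⇒x≡y u)

  treeNeighbour-avoiding : Σ[ X ∈ Subset n ] IsBlock G X × tadj T (⁅ u ⁆ ∪ ⁅ v ⁆) X × v ∈ X × u ∉ X
  treeNeighbour-avoiding with otherBlockAt δ≥2 u v
  ... | Y , isY , v∈Y , Y≢B
    with lastBlockBefore (spanning T isY isB) (reachableAvoiding-spread reachableAvoiding-⁅v⁆ isY Y≢B (x∈⁅x⁆ v) v∈Y)
  ...   | X , reachableX , X~B =
    X , proj₁ (subgraph T X~B) , symmetric T X~B , v∈X (proj₂ (proj₂ (proj₂ (subgraph T X~B)))) , u∉X
    where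
    u∉X = reachableAvoiding⇒∉ reachableX
    v∈X : Nonempty (X ∩ (⁅ u ⁆ ∪ ⁅ v ⁆)) → v ∈ X
    v∈X (z , z∈X∩B) with x∈p∩q⁻ X _ z∈X∩B
    ... | z∈X , z∈B with x∈⁅y⁆∪⁅z⁆⁻ z∈B
    ...   | inj₁ refl = ⊥-elim (u∉X z∈X)
    ...   | inj₂ refl = z∈X

proposition4p11 : ∀ {n} (G : Graph n) → Connected G → MinDegree≥ G 2 →
    (T : ReducedBlockTree G) → (B : Subset n) → IsBlock G B →
    (u v : Fin n) → u ≢ v → B ≡ ⁅ u ⁆ ∪ ⁅ v ⁆ →
    Σ (Subset n) λ Bu → Σ (Subset n) λ Bv →
      IsBlock G Bu × IsBlock G Bv × Bu ≢ Bv ×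
      tadj T B Bu × tadj T B Bv × u ∈ Bu × v ∈ Bv
proposition4p11 G _ δ≥2 T _ isB u v u≢v refl =
  let Bv , isBv , B~Bv , v∈Bv , _ = PairBlock.treeNeighbour-avoiding δ≥2 T u≢v isB
      isB′ = subst (IsBlock G) (∪-comm ⁅ u ⁆ ⁅ v ⁆) isB
      Bu , isBu , B~Bu , u∈Bu , v∉Bu = PairBlock.treeNeighbour-avoiding δ≥2 T (u≢v ∘ sym) isB′
      Bu≢Bv = λ Bu≡Bv → v∉Bu (subst (v ∈_) (sym Bu≡Bv) v∈Bv)
  in Bu , Bv , isBu , isBv , Bu≢Bv , subst (λ B → tadj T B Bu) (∪-comm ⁅ v ⁆ ⁅ u ⁆) B~Bu ,
     B~Bv , u∈Bu , v∈Bv
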